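{- Let $p:\mathbb{N}^{s}$ with $p>0$, let $\mathcal{L}$ be a FOLDS-signature of height $p$, and let $M:\mathcal{L}(0)\to\mathcal{U}$. Then the derivative $\mathcal{L}'_M$ is a FOLDS-signature (of height $p-1$).
   Context: Two-level type theory (2LTT): outer level with strict equality $\stackrel{\mathrm{s}}{=}$ (uniqueness of identity proofs, function extensionality), outer universes $\mathcal{U}^{s}$, strict naturals $\mathbb{N}^{s}$; inner level homotopy type theory with universes $\mathcal{U}$. A type is fibrant if isomorphic to an inner type, and trivially fibrant if isomorphic to a contractible inner type; a type $B$ is cofibrant if for every family $Y:B\to\mathcal{U}^{s}$ of (trivially) fibrant types, $\prod_{b:B}Y(b)$ is (trivially) fibrant. An inverse semi-category $\mathcal{L}$ of height $p$ consists of types $\mathcal{L}(n):\mathcal{U}^{s}$ for $n<p$, types $\hom_{\mathcal{L}}(K,L)$ for $K:\mathcal{L}(n)$, $L:\mathcal{L}(m)$ with $m<n$, and a strictly associative composition. The fanout of $K:\mathcal{L}(n)$ at $m<n$ is $\mathrm{Fan}_m(K):=\sum_{L:\mathcal{L}(m)}\hom_{\mathcal{L}}(K,L)$. A FOLDS-signature of height $p$ is an inverse semi-category in which each $\mathcal{L}(n)$ is fibrant and each fanout is cofibrant. Derivative: for $p>0$ and $M:\mathcal{L}(0)\to\mathcal{U}$, $\mathcal{L}'_M$ is the inverse semi-category of height $p-1$ with $\mathcal{L}'_M(n):=\sum_{K:\mathcal{L}(n+1)}\prod_{F:\mathrm{Fan}_0(K)}M(\pi_1F)$ and $\hom_{\mathcal{L}'_M}((K_1,\alpha_1),(K_2,\alpha_2)):=\sum_{f:\hom_{\mathcal{L}}(K_1,K_2)}\prod_{F:\mathrm{Fan}_0(K_2)}\alpha_1(F\circ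 f)\stackrel{\mathrm{s}}{=}\alpha_2(F)$, where for $F=(L,g)$ we write $F\circ f:=(L,g\circ f):\mathrm{Fan}_0(K_1)$; composition is induced from $\mathcal{L}$. -}

module Defs where

open import Level using (0ℓ)
open import Data.Nat using (ℕ; zero; suc; s≤s; z≤n)
open import Data.Fin using (Fin; zero; suc; _<_)
open import Data.Fin.Properties using (<-trans)
open import Data.Product using (Σ; _×_; _,_; proj₁; proj₂)
open import Function using (_∘_)
open import Function.Bundles using (_↔_)
open import Relation.Binary.PropositionalEquality
  using (_≡_; refl; sym; trans; cong)
open import Axiom.Extensionality.Propositional using (Extensionality)
open import Axiom.UniquenessOfIdentityProofs.WithK using (uip)

-- Two-level type theory, shallowly embedded.
-- Outer level  = Agda itself (Set = outer universe 𝒰ˢ, ≡ = strict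
--               equality ≡ˢ; UIP holds since K is on; funext is an
--               axiom of the outer level, recorded as a field).
-- Inner level  = a universe à la Tarski (U , El) closed under Π, Σ and
--               identity types, with strict (outer) computation rules.

record TwoLTT : Set₁ where
  field
    funext : Extensionality 0ℓ 0ℓ
    U      : Set
    El     : U → Set
    Πᵢ     : (A : U) → (El A → U) → U
    Π-iso  : (A : U) (B : El A → U) → El (Πᵢ A B) ↔ ((x : El A) → El (B x))
    Σᵢ     : (A : U) → (El A → U) → U
    Σ-iso  : (A : U) (B : El A → U) → El (Σᵢ A B) ↔ Σ (El A) (El ∘ B)
    Idᵢ    : (A : U) → El A → El A → U
    reflᵢ  : (A : U) (a : El A) → El (Idᵢ A a a)
    Jᵢ     : (A : U) (a : El A) (P : (x : El A) → El (Idᵢ A a x) → U)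
             → El (P a (reflᵢ A a)) → (x : El A) (e : El (Idᵢ A a x)) → El (P x e)
    Jβ     : (A : U) (a : El A) (P : (x : El A) → El (Idᵢ A a x) → U)
             (d : El (P a (reflᵢ A a))) → Jᵢ A a P d a (reflᵢ A a) ≡ d

module _ (T : TwoLTT) where
  open TwoLTT T

  isContrᵢ : U → U
  isContrᵢ A = Σᵢ A (λ a → Πᵢ A (λ x → Idᵢ A a x))

  Fibrant : Set → Set
  Fibrant X = Σ U (λ A → X ↔ El A)

  TrivFibrant : Set → Set
  TrivFibrant X = Σ U (λ A → (X ↔ El A) × El (isContrᵢ A))

  Cofibrant : Set → Set₁
  Cofibrant B =
      ((Y : B → Set) → ((b : B) → Fibrant (Y b)) → Fibrant ((b : B) → Y b))
    × ((Y : B → Set) → ((b : B) → TrivFibrant (Y b)) → TrivFibrant ((b : B) → Y b))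

record InvSemiCat (p : ℕ) : Set₁ where
  field
    Ob    : Fin p → Set
    Hom   : {n m : Fin p} → .(m < n) → Ob n → Ob m → Set
    comp  : {n m k : Fin p} .(km : k < m) .(mn : m < n)
            {K : Ob n} {L : Ob m} {N : Ob k}
            → Hom km L N → Hom mn K L → Hom (<-trans km mn) K N
    assoc : {n m k j : Fin p} .(jk : j < k) .(km : k < m) .(mn : m < n)
            {K : Ob n} {L : Ob m} {N : Ob k} {P : Ob j}
            (h : Hom jk N P) (g : Hom km L N) (f : Hom mn K L)
            → comp jk (<-trans km mn) h (comp km mn g f)
              ≡ comp (<-trans jk km) mn (comp jk km h g) f

  Fan : {n m : Fin p} .(mn : m < n) → Ob n → Set
  Fan {m = m} mn K = Σ (Ob m) (λ L → Hom mn K L)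

  _⊚_ : {n m k : Fin p} .{km : k < m} .{mn : m < n} {K : Ob n} {L : Ob m}
        → Fan km L → Hom mn K L → Fan (<-trans km mn) K
  _⊚_ {km = km} {mn = mn} (N , g) f = N , comp km mn g f

open InvSemiCat public

IsFOLDS : (T : TwoLTT) {p : ℕ} → InvSemiCat p → Set₁
IsFOLDS T {p} 𝓛 =
    ((n : Fin p) → Fibrant T (Ob 𝓛 n))
  × ((n m : Fin p) (mn : m < n) (K : Ob 𝓛 n) → Cofibrant T (Fan 𝓛 mn K))

module Derivative (T : TwoLTT) {q : ℕ} (𝓛 : InvSemiCat (suc q))
                  (M : Ob 𝓛 zero → TwoLTT.U T) where
  open TwoLTT T

  z< : (n : Fin q) → _<_ {suc q} zero (suc n)
  z< n = s≤s z≤n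

  Ob' : Fin q → Set
  Ob' n = Σ (Ob 𝓛 (suc n)) (λ K → (F : Fan 𝓛 (z< n) K) → El (M (proj₁ F)))

  record Hom' {n m : Fin q} .(mn : m < n) (K : Ob' n) (L : Ob' m) : Set where
    constructor _,_
    field
      mor : Hom 𝓛 (s≤s mn) (proj₁ K) (proj₁ L)
      law : (F : Fan 𝓛 (z< m) (proj₁ L)) → proj₂ K (_⊚_ 𝓛 F mor) ≡ proj₂ L F

  ap-α : {n : Fin q} {K : Ob 𝓛 (suc n)} {P : Ob 𝓛 zero}
         (α : (F : Fan 𝓛 (z< n) K) → El (M (proj₁ F)))
         {h₁ h₂ : Hom 𝓛 (z< n) K P} → h₁ ≡ h₂ → α (P , h₁) ≡ α (P , h₂)
  ap-α α refl = refl

  comp' : {n m k : Fin q} .(km : k < m) .(mn : m < n)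
          {K : Ob' n} {L : Ob' m} {N : Ob' k}
          → Hom' km L N → Hom' mn K L → Hom' (<-trans km mn) K N
  comp' {k = k} km mn {K₁ , α₁} {K₂ , α₂} {K₃ , α₃} (g , eg) (f , ef) =
      comp 𝓛 (s≤s km) (s≤s mn) g f
    , λ { (P , h) →
          trans (ap-α α₁ (assoc 𝓛 (z< k) (s≤s km) (s≤s mn) h g f))
                (trans (ef (P , comp 𝓛 (z< k) (s≤s km) h g)) (eg (P , h))) }

  Hom'-≡ : {n m : Fin q} .{mn : m < n} {K : Ob' n} {L : Ob' m}
           {f₁ f₂ : Hom 𝓛 (s≤s mn) (proj₁ K) (proj₁ L)} {e₁ : _} {e₂ : _}
           → f₁ ≡ f₂ → _≡_ {A = Hom' mn K L} (f₁ , e₁) (f₂ , e₂)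
  Hom'-≡ {f₁ = f} {e₁ = e₁} {e₂} refl =
    cong (f ,_) (funext (λ F → uip (e₁ F) (e₂ F)))

  assoc' : {n m k j : Fin q} .(jk : j < k) .(km : k < m) .(mn : m < n)
           {K : Ob' n} {L : Ob' m} {N : Ob' k} {P : Ob' j}
           (h : Hom' jk N P) (g : Hom' km L N) (f : Hom' mn K L)
           → comp' jk (<-trans km mn) h (comp' km mn g f)
             ≡ comp' (<-trans jk km) mn (comp' jk km h g) f
  assoc' jk km mn (h , _) (g , _) (f , _) =
    Hom'-≡ (assoc 𝓛 (s≤s jk) (s≤s km) (s≤s mn) h g f)

  𝓛' : InvSemiCat q
  𝓛' = record { Ob = Ob' ; Hom = Hom' ; comp = comp' ; assoc = assoc' }

derivative : (T : TwoLTT) {q : ℕ} (𝓛 : InvSemiCat (suc q))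
             (M : Ob 𝓛 zero → TwoLTT.U T) → InvSemiCat q
derivative T 𝓛 M = Derivative.𝓛' T 𝓛 M

-- * Levels are fibrant.  𝓛'_M(n) is the Σ-type over the fibrant 𝓛(n+1) of the
--   dependent functions  Π (F : Fan₀ K) M(π₁ F).  Each M(π₁ F) is inner, so
--   this Π-type is fibrant because Fan₀ K is cofibrant; and fibrant types are
--   closed under Σ.
--
-- * Fanouts are cofibrant.  A fanout element ((L , β) , (f , law)) of
--   (K , α) in 𝓛'_M is determined by the 𝓛-fanout element (L , f): the law
--   forces β = α(_ ∘ f), and the law itself is unique by UIP.  Hence the
--   fanouts of 𝓛'_M are isomorphic to fanouts of 𝓛, and cofibrancy is
--   invariant under isomorphism, since a Π-type can be reindexed along an
--   isomorphism of its domain (this needs function extensionality).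
module Submission where

open import Defs
open import Level using (0ℓ)
open import Data.Nat using (ℕ; suc; s≤s)
open import Data.Fin using (Fin; zero; _<_) renaming (suc to fsuc)
open import Data.Product using (Σ; _,_; proj₁; proj₂)
open import Function using (_∘_)
open import Function.Bundles using (_↔_; Inverse; mk↔ₛ′)
open import Function.Properties.Inverse using (↔-sym; ↔-trans; ↔-refl)
open import Data.Product.Function.Dependent.Propositional using (Σ-↔)
open import Relation.Binary.PropositionalEquality
  using (_≡_; refl; cong; subst; module ≡-Reasoning)
open import Relation.Binary.PropositionalEquality.Properties using (dcong; subst-∘)
open import Axiom.Extensionality.Propositional using (Extensionality)
open import Axiom.UniquenessOfIdentityProofs.WithK using (uip)

-- The inverse transports along the counit; that the two
-- round trips are identities uses the triangle identity, which UIP gives.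
Π-reindex : Extensionality 0ℓ 0ℓ → {B B' : Set} (i : B ↔ B') (Y : B → Set)
          → ((b : B) → Y b) ↔ ((b' : B') → Y (Inverse.from i b'))
Π-reindex funext {B} {B'} i Y =
  mk↔ₛ′ (λ h → h ∘ from) extend (funext ∘ extend-restrict) (funext ∘ restrict-extend)
  where
  open Inverse i

  extend : ((b' : B') → Y (from b')) → (b : B) → Y b
  extend k b = subst Y (strictlyInverseʳ b) (k (to b))

  restrict-extend : (h : (b : B) → Y b) (b : B) → extend (h ∘ from) b ≡ h b
  restrict-extend h b = dcong h (strictlyInverseʳ b)

  extend-restrict : (k : (b' : B') → Y (from b')) (b' : B') → extend k (from b') ≡ k b'
  extend-restrict k b' = begin
      subst Y (strictlyInverseʳ (from b')) (k (to (from b')))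
    ≡⟨ cong (λ e → subst Y e (k (to (from b'))))
            (uip (strictlyInverseʳ (from b')) (cong from (strictlyInverseˡ b'))) ⟩
      subst Y (cong from (strictlyInverseˡ b')) (k (to (from b')))
    ≡⟨ subst-∘ (strictlyInverseˡ b') ⟨
      subst (Y ∘ from) (strictlyInverseˡ b') (k (to (from b')))
    ≡⟨ dcong k (strictlyInverseˡ b') ⟩
      k b'
    ∎
    where open ≡-Reasoning

module TwoLevelFacts (T : TwoLTT) where
  open TwoLTT T

  inner-fibrant : (A : U) → Fibrant T (El A)
  inner-fibrant A = A , ↔-refl

  Σ-fibrant : {X : Set} {P : X → Set}
            → Fibrant T X → ((x : X) → Fibrant T (P x)) → Fibrant T (Σ X P)
  Σ-fibrant {X} {P} (A , i) fibP =
      Σᵢ A (proj₁ ∘ fibP ∘ from)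
    , ↔-trans (↔-sym (Σ-↔ {A = P ∘ from} {B = P} (↔-sym i) ↔-refl))
      (↔-trans (Σ-↔ ↔-refl (λ {a} → proj₂ (fibP (from a))))
               (↔-sym (Σ-iso A (proj₁ ∘ fibP ∘ from))))
    where open Inverse i

  cofibrant-↔ : {B B' : Set} → B ↔ B' → Cofibrant T B' → Cofibrant T B
  cofibrant-↔ i (Π-fibrant , Π-trivFibrant) =
      (λ Y fibY →
        let (A , j) = Π-fibrant (Y ∘ from) (fibY ∘ from)
        in A , ↔-trans (Π-reindex funext i Y) j)
    , (λ Y fibY →
        let (A , j , c) = Π-trivFibrant (Y ∘ from) (fibY ∘ from)
        in A , ↔-trans (Π-reindex funext i Y) j , c)
    where open Inverse i

module DerivativeFacts (T : TwoLTT) {q : ℕ} (𝓛 : InvSemiCat (suc q))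
                       (M : Ob 𝓛 zero → TwoLTT.U T) where
  open TwoLTT T
  open TwoLevelFacts T
  open Derivative T 𝓛 M

  Ob'-fibrant : (n : Fin q) → Fibrant T (Ob 𝓛 (fsuc n))
              → ((K : Ob 𝓛 (fsuc n)) → Cofibrant T (Fan 𝓛 (z< n) K))
              → Fibrant T (Ob' n)
  Ob'-fibrant n fibK cofFan =
    Σ-fibrant fibK (λ K → proj₁ (cofFan K) (El ∘ M ∘ proj₁) (inner-fibrant ∘ M ∘ proj₁))

  module _ {n m : Fin q} (mn : m < n) (K : Ob 𝓛 (fsuc n))
           (α : (F : Fan 𝓛 (z< n) K) → El (M (proj₁ F))) where

    lift : Fan 𝓛 (s≤s mn) K → Fan 𝓛' mn (K , α)
    lift (L , f) = (L , α ∘ (λ F → _⊚_ 𝓛 F f)) , (f , λ F → refl)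

    -- Every fanout element of (K , α) is the lift of its underlying morphism:
    -- the law determines the label, and the law itself is unique by UIP.
    lift-unique : (L : Ob 𝓛 (fsuc m)) (f : Hom 𝓛 (s≤s mn) K L)
                  (β : (F : Fan 𝓛 (z< m) L) → El (M (proj₁ F)))
                  (law : (F : Fan 𝓛 (z< m) L) → α (_⊚_ 𝓛 F f) ≡ β F)
                → lift (L , f) ≡ ((L , β) , (f , law))
    lift-unique L f β law = along (funext law) law
      where
      along : {β : (F : Fan 𝓛 (z< m) L) → El (M (proj₁ F))} → α ∘ (λ F → _⊚_ 𝓛 F f) ≡ β
            → (law : (F : Fan 𝓛 (z< m) L) → α (_⊚_ 𝓛 F f) ≡ β F)
            → lift (L , f) ≡ ((L , β) , (f , law))
      along refl law = cong (λ l → (L , _) , (f , l)) (funext (λ F → uip refl (law F)))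

    Fan'-↔-Fan : Fan 𝓛' mn (K , α) ↔ Fan 𝓛 (s≤s mn) K
    Fan'-↔-Fan = mk↔ₛ′ (λ { ((L , _) , (f , _)) → L , f }) lift (λ _ → refl)
                       (λ { ((L , β) , (f , law)) → lift-unique L f β law })

propositionA13 : (T : TwoLTT) (q : ℕ) (𝓛 : InvSemiCat (suc q))
                 → IsFOLDS T 𝓛
                 → (M : Ob 𝓛 zero → TwoLTT.U T)
                 → IsFOLDS T (derivative T 𝓛 M)
propositionA13 T q 𝓛 (fibrant , cofibrant) M =
    (λ n → Ob'-fibrant n (fibrant (fsuc n)) (cofibrant (fsuc n) zero (z< n)))
  , (λ n m mn (K , α) →
       cofibrant-↔ (Fan'-↔-Fan mn K α) (cofibrant (fsuc n) (fsuc m) (s≤s mn) K))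
  where
  open TwoLevelFacts T
  open DerivativeFacts T 𝓛 M
  open Derivative T 𝓛 M using (z<)
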